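{- If $G$ is a GP$5$-graph, then $\gamma_{pr}(G)=\frac{2}{3}|V(G)|$.
   Context: All graphs are finite and simple. A graph $G=(V,E)$ is a GP$5$-graph if it is obtained from a connected graph $H=(V_H,E_H)$ with $V_H=\{v_1,\dots,v_n\}$ by adding, for each $v_i$, a vertex-disjoint path $a_ib_ic_id_ie_i$ on five new vertices and joining $v_i$ to the central vertex $c_i$: formally $V=V_H\cup\{a_i,b_i,c_i,d_i,e_i : i\in[n]\}$ and $E=E_H\cup\{v_ic_i,\,c_ib_i,\,c_id_i,\,b_ia_i,\,d_ie_i : i\in[n]\}$. For a graph with no isolated vertices, a paired dominating set is a set $D$ of vertices such that every vertex outside $D$ has a neighbor in $D$ and the subgraph induced by $D$ has a perfect matching; $\gamma_{pr}(G)$ denotes the minimum cardinality of a paired dominating set of $G$. -}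

module Defs where

open import Data.Nat using (ℕ; _*_)
open import Data.Fin using (Fin; zero; suc; remQuot)
open import Data.Fin.Subset using (Subset; _∈_; _∉_; ∣_∣)
open import Data.Product using (Σ; _×_; _,_; ∃-syntax)
open import Relation.Binary.PropositionalEquality using (_≡_)
open import Relation.Nullary using (¬_)

record SimpleGraph (N : ℕ) : Set₁ where
  field
    Adj     : Fin N → Fin N → Set
    sym     : ∀ {u v} → Adj u v → Adj v u
    irrefl  : ∀ {v} → ¬ Adj v v

data Reachable {N : ℕ} (Adj : Fin N → Fin N → Set) : Fin N → Fin N → Set where
  here : ∀ {u} → Reachable Adj u u
  step : ∀ {u v w} → Adj u v → Reachable Adj v w → Reachable Adj u w

Connected : {N : ℕ} → SimpleGraph N → Set
Connected {N} H = ∀ (u v : Fin N) → Reachable (SimpleGraph.Adj H) u v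

Dominating : {N : ℕ} → (Fin N → Fin N → Set) → Subset N → Set
Dominating {N} Adj D = ∀ (v : Fin N) → v ∉ D → ∃[ u ] (u ∈ D × Adj v u)

-- the subgraph induced by D has a perfect matching, given as a partner
-- function M: each v ∈ D is matched to the adjacent vertex M v ∈ D, and
-- M v is matched back to v (so the matched pairs are disjoint edges
-- covering D).
HasPerfectMatchingOn : {N : ℕ} → (Fin N → Fin N → Set) → Subset N → Set
HasPerfectMatchingOn {N} Adj D =
  Σ (Fin N → Fin N) λ M →
    ∀ (v : Fin N) → v ∈ D → (M v ∈ D × Adj v (M v) × M (M v) ≡ v)

IsPairedDominatingSet : {N : ℕ} → (Fin N → Fin N → Set) → Subset N → Set
IsPairedDominatingSet Adj D = Dominating Adj D × HasPerfectMatchingOn Adj D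

IsPairedDominationNumber : {N : ℕ} → (Fin N → Fin N → Set) → ℕ → Set
IsPairedDominationNumber {N} Adj k =
  (Σ (Subset N) λ D → IsPairedDominatingSet Adj D × ∣ D ∣ ≡ k)
  × (∀ (D : Subset N) → IsPairedDominatingSet Adj D → k Data.Nat.≤ ∣ D ∣)

-- GP5-graphs.
-- Vertices are pairs (layer , i) with layer : Fin 6, i : Fin n:
--   layer 0 = v_i, 1 = a_i, 2 = b_i, 3 = c_i, 4 = d_i, 5 = e_i.

data GadgetEdge : Fin 6 → Fin 6 → Set where
  vc : GadgetEdge zero (suc (suc (suc zero)))
  cv : GadgetEdge (suc (suc (suc zero))) zero
  cb : GadgetEdge (suc (suc (suc zero))) (suc (suc zero))
  bc : GadgetEdge (suc (suc zero)) (suc (suc (suc zero)))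
  cd : GadgetEdge (suc (suc (suc zero))) (suc (suc (suc (suc zero))))
  dc : GadgetEdge (suc (suc (suc (suc zero)))) (suc (suc (suc zero)))
  ba : GadgetEdge (suc (suc zero)) (suc zero)
  ab : GadgetEdge (suc zero) (suc (suc zero))
  de : GadgetEdge (suc (suc (suc (suc zero)))) (suc (suc (suc (suc (suc zero)))))
  ed : GadgetEdge (suc (suc (suc (suc (suc zero))))) (suc (suc (suc (suc zero))))

data GP5Adj' {n : ℕ} (H : SimpleGraph n) : Fin 6 × Fin n → Fin 6 × Fin n → Set where
  hEdge : ∀ {i j} → SimpleGraph.Adj H i j → GP5Adj' H (zero , i) (zero , j)
  gEdge : ∀ {k l i} → GadgetEdge k l → GP5Adj' H (k , i) (l , i)

GP5Adj : {n : ℕ} → SimpleGraph n → Fin (6 * n) → Fin (6 * n) → Set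
GP5Adj {n} H x y = GP5Adj' H (remQuot n x) (remQuot n y)

-- Write v, a, b, c, d, e for the vertices of the gadget attached at an
-- index j (layers 0-5 of the vertex set Fin 6 × Fin n).  The argument is
-- purely local to the gadgets.
--
--  * Upper bound: D₀ = {b, c, d, e in every gadget} with the matching
--    b–c, d–e is a paired dominating set (v is dominated by c, a by b);
--    it has 4 vertices per gadget.
--  * Lower bound: a and e are leaves, so their supports b and d lie in
--    every paired dominating set D.  The partner of b is a or c, the
--    partner of d is c or e, and the two partners differ because the
--    matching is an involution.  Hence D meets every gadget in ≥ 4 vertices.
module Submission where

open import Defs
open import Data.Nat using (ℕ; zero; suc; _+_; _*_; _≤_; z≤n)
open import Data.Nat.Properties
  using (+-mono-≤; +-assoc; m≤m+n; m≤n+m; ≤-trans; n≤1+n; +-0-commutativeMonoid; module ≤-Reasoning)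
open import Data.Nat.Solver using (module +-*-Solver)
open import Data.Bool using (Bool; true; false)
open import Data.Fin using (Fin; combine; remQuot; _↑ˡ_; _↑ʳ_)
open import Data.Fin.Patterns using (0F; 1F; 2F; 3F; 4F; 5F)
open import Data.Fin.Properties using (remQuot-combine; combine-remQuot; combine-injectiveˡ)
open import Data.Fin.Subset using (Subset; _∈_; _∉_; ∣_∣)
open import Data.Fin.Subset.Properties using (_∈?_)
open import Data.Vec using ([]; _∷_; lookup; tabulate)
open import Data.Vec.Properties using (lookup∘tabulate; []=⇒lookup; lookup⇒[]=)
open import Data.Product using (Σ; _×_; _,_; proj₁; proj₂; ∃-syntax)
open import Data.Sum using (_⊎_; inj₁; inj₂)
import Data.Sum as Sum
open import Function using (_∘_)
open import Relation.Binary.PropositionalEquality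
open import Relation.Nullary using (yes; no; contradiction)
open import Algebra.Properties.CommutativeMonoid.Sum +-0-commutativeMonoid
  using (sum; sum-syntax; ∑-comm; sum-cong-≗)

sum-++ : ∀ m {n} (f : Fin (m + n) → ℕ) →
  sum f ≡ (∑[ i < m ] f (i ↑ˡ n)) + (∑[ j < n ] f (m ↑ʳ j))
sum-++ zero    f = refl
sum-++ (suc m) f =
  trans (cong (f 0F +_) (sum-++ m (f ∘ Fin.suc))) (sym (+-assoc (f 0F) _ _))

sum-combine : ∀ m {n} (f : Fin (m * n) → ℕ) →
  sum f ≡ ∑[ i < m ] ∑[ j < n ] f (combine i j)
sum-combine zero        f = refl
sum-combine (suc m) {n} f =
  trans (sum-++ n f) (cong ((∑[ j < n ] f (j ↑ˡ m * n)) +_) (sum-combine m (f ∘ (n ↑ʳ_))))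

sum-mono : ∀ {n} {f g : Fin n → ℕ} → (∀ i → f i ≤ g i) → sum f ≤ sum g
sum-mono {zero}  f≤g = z≤n
sum-mono {suc n} f≤g = +-mono-≤ (f≤g 0F) (sum-mono (f≤g ∘ Fin.suc))

sum-const : ∀ n c → ∑[ i < n ] c ≡ n * c
sum-const zero    c = refl
sum-const (suc n) c = cong (c +_) (sum-const n c)

bit : Bool → ℕ
bit true  = 1
bit false = 0

∣∣≡sum : ∀ {N} (D : Subset N) → ∣ D ∣ ≡ ∑[ x < N ] bit (lookup D x)
∣∣≡sum []          = refl
∣∣≡sum (true ∷ D)  = cong suc (∣∣≡sum D)
∣∣≡sum (false ∷ D) = ∣∣≡sum D

∣∣≡sum-of-blocks : ∀ {m n} (D : Subset (m * n)) →
  ∣ D ∣ ≡ ∑[ j < n ] ∑[ i < m ] bit (lookup D (combine i j))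
∣∣≡sum-of-blocks {m} {n} D = begin
  ∣ D ∣                                             ≡⟨ ∣∣≡sum D ⟩
  ∑[ x < m * n ] bit (lookup D x)                   ≡⟨ sum-combine m _ ⟩
  ∑[ i < m ] ∑[ j < n ] bit (lookup D (combine i j)) ≡⟨ ∑-comm {m} {n} (λ i j → bit (lookup D (combine i j))) ⟩
  ∑[ j < n ] ∑[ i < m ] bit (lookup D (combine i j)) ∎
  where open ≡-Reasoning

IsMatching : ∀ {N} → (Fin N → Fin N → Set) → Subset N → (Fin N → Fin N) → Set
IsMatching {N} Adj D M = ∀ (v : Fin N) → v ∈ D → (M v ∈ D × Adj v (M v) × M (M v) ≡ v)

module _ {N : ℕ} {Adj : Fin N → Fin N → Set} where

  -- A support vertex (the unique neighbour s of a leaf a) lies in every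
  -- paired dominating set: a is either matched to s or dominated by s.
  support∈ : ∀ {D a s} → IsPairedDominatingSet Adj D →
             (∀ {u} → Adj a u → u ≡ s) → s ∈ D
  support∈ {D} {a} (dom , M , mat) onlyNeighbour with a ∈? D
  ... | yes a∈D = let (Ma∈D , a~Ma , _) = mat a a∈D in
                  subst (_∈ D) (onlyNeighbour a~Ma) Ma∈D
  ... | no  a∉D = let (u , u∈D , a~u) = dom a a∉D in
                  subst (_∈ D) (onlyNeighbour a~u) u∈D

  -- Matching partners are an involution on D, hence injective there.
  partner-injective : ∀ {D M x y} → IsMatching Adj D M →
                      x ∈ D → y ∈ D → M x ≡ M y → x ≡ y
  partner-injective {M = M} {x} {y} mat x∈D y∈D Mx≡My = begin
    x         ≡⟨ proj₂ (proj₂ (mat x x∈D)) ⟨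
    M (M x)   ≡⟨ cong M Mx≡My ⟩
    M (M y)   ≡⟨ proj₂ (proj₂ (mat y y∈D)) ⟩
    y         ∎
    where open ≡-Reasoning

data AtLeastTwo (x y z : Bool) : Set where
  xy : x ≡ true → y ≡ true → AtLeastTwo x y z
  xz : x ≡ true → z ≡ true → AtLeastTwo x y z
  yz : y ≡ true → z ≡ true → AtLeastTwo x y z

gadget-count : (f : Fin 6 → Bool) → f 2F ≡ true → f 4F ≡ true →
               AtLeastTwo (f 1F) (f 3F) (f 5F) → 4 ≤ ∑[ l < 6 ] bit (f l)
gadget-count f b d two rewrite b | d = ≤-trans (twoOfACE two) (m≤n+m _ (bit (f 0F)))
  where
  -- with b = d = true the sum is bit v + (bit a + (1 + (bit c + (1 + (bit e + 0)))))
  twoOfACE : ∀ {x y z} → AtLeastTwo x y z →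
             4 ≤ bit x + (1 + (bit y + (1 + (bit z + 0))))
  twoOfACE               (xy refl refl) = m≤m+n 4 _
  twoOfACE {y = false}   (xz refl refl) = m≤m+n 4 0
  twoOfACE {y = true}    (xz refl refl) = n≤1+n 4
  twoOfACE {x = false}   (yz refl refl) = m≤m+n 4 0
  twoOfACE {x = true}    (yz refl refl) = n≤1+n 4

module GP5 {n : ℕ} (H : SimpleGraph n) where

  V : Set
  V = Fin (6 * n)

  Adj : V → V → Set
  Adj = GP5Adj H

  vertex : Fin 6 → Fin n → V
  vertex = combine

  layer : V → Fin 6
  layer x = proj₁ (remQuot {6} n x)

  index : V → Fin n
  index x = proj₂ (remQuot {6} n x)

  by-vertex : {P : V → Set} → (∀ l j → P (vertex l j)) → ∀ x → P x
  by-vertex {P} p x = subst P (combine-remQuot {6} n x) (p (layer x) (index x))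

  vertex-injectiveˡ : ∀ l l' j → vertex l j ≡ vertex l' j → l ≡ l'
  vertex-injectiveˡ l l' j = combine-injectiveˡ l j l' j

  gadgetEdge : ∀ {l l' j} → GadgetEdge l l' → Adj (vertex l j) (vertex l' j)
  gadgetEdge {l} {l'} {j} e =
    subst₂ (GP5Adj' H) (sym (remQuot-combine l j)) (sym (remQuot-combine l' j)) (gEdge e)

  neighbour : ∀ {l j u} → Adj (vertex l j) u → GP5Adj' H (l , j) (remQuot n u)
  neighbour {l} {j} {u} = subst (λ p → GP5Adj' H p (remQuot n u)) (remQuot-combine l j)

  coordinates : ∀ {u l j} → remQuot n u ≡ (l , j) → u ≡ vertex l j
  coordinates {u} eq = trans (sym (combine-remQuot {6} n u)) (cong (λ p → combine (proj₁ p) (proj₂ p)) eq)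

  neighbours-a : ∀ {j u} → Adj (vertex 1F j) u → u ≡ vertex 2F j
  neighbours-a = coordinates ∘ inv ∘ neighbour
    where inv : ∀ {j q} → GP5Adj' H (1F , j) q → q ≡ (2F , j)
          inv (gEdge ab) = refl

  neighbours-e : ∀ {j u} → Adj (vertex 5F j) u → u ≡ vertex 4F j
  neighbours-e = coordinates ∘ inv ∘ neighbour
    where inv : ∀ {j q} → GP5Adj' H (5F , j) q → q ≡ (4F , j)
          inv (gEdge ed) = refl

  neighbours-b : ∀ {j u} → Adj (vertex 2F j) u → u ≡ vertex 1F j ⊎ u ≡ vertex 3F j
  neighbours-b = Sum.map coordinates coordinates ∘ inv ∘ neighbour
    where inv : ∀ {j q} → GP5Adj' H (2F , j) q → q ≡ (1F , j) ⊎ q ≡ (3F , j)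
          inv (gEdge ba) = inj₁ refl
          inv (gEdge bc) = inj₂ refl

  neighbours-d : ∀ {j u} → Adj (vertex 4F j) u → u ≡ vertex 3F j ⊎ u ≡ vertex 5F j
  neighbours-d = Sum.map coordinates coordinates ∘ inv ∘ neighbour
    where inv : ∀ {j q} → GP5Adj' H (4F , j) q → q ≡ (3F , j) ⊎ q ≡ (5F , j)
          inv (gEdge dc) = inj₁ refl
          inv (gEdge de) = inj₂ refl

  inD₀ : Fin 6 → Bool
  inD₀ 0F = false
  inD₀ 1F = false
  inD₀ _  = true

  partner₀ : Fin 6 → Fin 6
  partner₀ 2F = 3F
  partner₀ 3F = 2F
  partner₀ 4F = 5F
  partner₀ 5F = 4F
  partner₀ l  = l

  D₀ : Subset (6 * n)
  D₀ = tabulate (inD₀ ∘ layer)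

  M₀ : V → V
  M₀ x = vertex (partner₀ (layer x)) (index x)

  lookup-D₀ : ∀ l j → lookup D₀ (vertex l j) ≡ inD₀ l
  lookup-D₀ l j = trans (lookup∘tabulate _ (vertex l j)) (cong (inD₀ ∘ proj₁) (remQuot-combine l j))

  ∈D₀ : ∀ l j → inD₀ l ≡ true → vertex l j ∈ D₀
  ∈D₀ l j eq = lookup⇒[]= (vertex l j) D₀ (trans (lookup-D₀ l j) eq)

  M₀-vertex : ∀ l j → M₀ (vertex l j) ≡ vertex (partner₀ l) j
  M₀-vertex l j = cong (λ p → vertex (partner₀ (proj₁ p)) (proj₂ p)) (remQuot-combine l j)

  D₀-dominating : Dominating Adj D₀
  D₀-dominating = by-vertex dominate
    where
    dominate : ∀ l j → vertex l j ∉ D₀ → ∃[ u ] (u ∈ D₀ × Adj (vertex l j) u)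
    dominate 0F j _  = vertex 3F j , ∈D₀ 3F j refl , gadgetEdge vc
    dominate 1F j _  = vertex 2F j , ∈D₀ 2F j refl , gadgetEdge ab
    dominate 2F j ∉D = contradiction (∈D₀ 2F j refl) ∉D
    dominate 3F j ∉D = contradiction (∈D₀ 3F j refl) ∉D
    dominate 4F j ∉D = contradiction (∈D₀ 4F j refl) ∉D
    dominate 5F j ∉D = contradiction (∈D₀ 5F j refl) ∉D

  D₀-matched : IsMatching Adj D₀ M₀
  D₀-matched = by-vertex matched
    where
    layer-in-D₀ : ∀ l j → vertex l j ∈ D₀ → inD₀ l ≡ true
    layer-in-D₀ l j v∈D = trans (sym (lookup-D₀ l j)) ([]=⇒lookup v∈D)

    matched : ∀ l j → vertex l j ∈ D₀ →
      M₀ (vertex l j) ∈ D₀ × Adj (vertex l j) (M₀ (vertex l j)) × M₀ (M₀ (vertex l j)) ≡ vertex l j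
    matched 0F j v∈D with () ← layer-in-D₀ 0F j v∈D
    matched 1F j v∈D with () ← layer-in-D₀ 1F j v∈D
    matched 2F j _ rewrite M₀-vertex 2F j | M₀-vertex 3F j = ∈D₀ 3F j refl , gadgetEdge bc , refl
    matched 3F j _ rewrite M₀-vertex 3F j | M₀-vertex 2F j = ∈D₀ 2F j refl , gadgetEdge cb , refl
    matched 4F j _ rewrite M₀-vertex 4F j | M₀-vertex 5F j = ∈D₀ 5F j refl , gadgetEdge de , refl
    matched 5F j _ rewrite M₀-vertex 5F j | M₀-vertex 4F j = ∈D₀ 4F j refl , gadgetEdge ed , refl

  ∣D₀∣ : ∣ D₀ ∣ ≡ n * 4
  ∣D₀∣ = begin
    ∣ D₀ ∣                                           ≡⟨ ∣∣≡sum-of-blocks {6} {n} D₀ ⟩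
    ∑[ j < n ] ∑[ l < 6 ] bit (lookup D₀ (vertex l j)) ≡⟨ sum-cong-≗ (λ j → sum-cong-≗ (λ l → cong bit (lookup-D₀ l j))) ⟩
    ∑[ j < n ] 4                                     ≡⟨ sum-const n 4 ⟩
    n * 4                                            ∎
    where open ≡-Reasoning

  D₀-paired-dominating : IsPairedDominatingSet Adj D₀
  D₀-paired-dominating = D₀-dominating , M₀ , D₀-matched

  module _ {D : Subset (6 * n)} (pds : IsPairedDominatingSet Adj D) (j : Fin n) where

    private
      M : V → V
      M = proj₁ (proj₂ pds)

      mat : IsMatching Adj D M
      mat = proj₂ (proj₂ pds)

      marked : Fin 6 → Bool
      marked l = lookup D (vertex l j)

      b∈D : vertex 2F j ∈ D
      b∈D = support∈ pds neighbours-a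

      d∈D : vertex 4F j ∈ D
      d∈D = support∈ pds neighbours-e

      partner-marks : ∀ {x} l → x ∈ D → M x ≡ vertex l j → marked l ≡ true
      partner-marks {x} _ x∈D eq = []=⇒lookup (subst (_∈ D) eq (proj₁ (mat x x∈D)))

      b≢d : vertex 2F j ≢ vertex 4F j
      b≢d eq with () ← vertex-injectiveˡ 2F 4F j eq

      -- the partners of b and d are two distinct vertices among a, c, e
      two-of-ace : AtLeastTwo (marked 1F) (marked 3F) (marked 5F)
      two-of-ace with neighbours-b (proj₁ (proj₂ (mat _ b∈D)))
                    | neighbours-d (proj₁ (proj₂ (mat _ d∈D)))
      ... | inj₁ Mb≡a | inj₁ Md≡c = xy (partner-marks 1F b∈D Mb≡a) (partner-marks 3F d∈D Md≡c)
      ... | inj₁ Mb≡a | inj₂ Md≡e = xz (partner-marks 1F b∈D Mb≡a) (partner-marks 5F d∈D Md≡e)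
      ... | inj₂ Mb≡c | inj₂ Md≡e = yz (partner-marks 3F b∈D Mb≡c) (partner-marks 5F d∈D Md≡e)
      ... | inj₂ Mb≡c | inj₁ Md≡c =
        contradiction (partner-injective {Adj = Adj} mat b∈D d∈D (trans Mb≡c (sym Md≡c))) b≢d

    gadget-lower : 4 ≤ ∑[ l < 6 ] bit (lookup D (vertex l j))
    gadget-lower = gadget-count marked ([]=⇒lookup b∈D) ([]=⇒lookup d∈D) two-of-ace

  lower-bound : ∀ D → IsPairedDominatingSet Adj D → n * 4 ≤ ∣ D ∣
  lower-bound D pds = begin
    n * 4                                             ≡⟨ sum-const n 4 ⟨
    ∑[ j < n ] 4                                      ≤⟨ sum-mono (gadget-lower pds) ⟩
    ∑[ j < n ] ∑[ l < 6 ] bit (lookup D (vertex l j)) ≡⟨ ∣∣≡sum-of-blocks {6} {n} D ⟨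
    ∣ D ∣                                             ∎
    where open ≤-Reasoning

theorem3 : (n : ℕ) (H : SimpleGraph n) → Connected H →
    Σ ℕ (λ k → IsPairedDominationNumber (GP5Adj H) k × 3 * k ≡ 2 * (6 * n))
theorem3 n H _ =
  n * 4 , ((D₀ , D₀-paired-dominating , ∣D₀∣) , lower-bound) , two-thirds
  where
  open GP5 H
  open +-*-Solver
  two-thirds : 3 * (n * 4) ≡ 2 * (6 * n)
  two-thirds = solve 1 (λ m → con 3 :* (m :* con 4) := con 2 :* (con 6 :* m)) refl n
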